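{- Let $m\ge 3$ and let $n\ge 3$ be odd. Let $G(*)$ be the subgraph of $G_{m,n}=S_m\Box P_n$ induced by the vertex set $V(S_m)\times\{1,\tfrac{n+1}{2},n\}$ (i.e. by the three star copies $S_{m(1)}$, $S_{m(\frac{n+1}{2})}$, $S_{m(n)}$). Then the radio number of $G(*)$ in $G_{m,n}$ satisfies $$rn(G(*))\ge \tfrac{1}{2}\left(2mn+4m-n+5\right).$$
   Context: $S_m$ is the star on $m$ vertices with center $c$ and leaves; $P_n$ is the path with vertices $1,\dots,n$. $G_{m,n}=S_m\Box P_n$ has vertex set $V(S_m)\times\{1,\dots,n\}$, with $(a,i)\sim(b,j)$ iff ($a=b$ and $|i-j|=1$) or ($i=j$ and $ab\in E(S_m)$). Its distance is $d((a,i),(b,j))=d_{S_m}(a,b)+|i-j|$ and its diameter is $n+1$. For $i$ fixed, $S_{m(i)}$ denotes the copy of $S_m$ induced by $V(S_m)\times\{i\}$. For a subset $H$ of vertices (or induced subgraph) of $G_{m,n}$, a radio labeling of $H$ in $G_{m,n}$ is a function $f:V(H)\to\mathbb{Z}_{\ge 0}$ with $|f(u)-f(v)|\ge \mathrm{diam}(G_{m,n})+1-d_{G_{m,n}}(u,v)$ for all distinct $u,v\in V(H)$ (distances and diameter taken in $G_{m,n}$); its span is $\max f-\min f$, and $rn(H)$ is the minimum span over all such labelings. -}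

module Defs where

open import Data.Nat using (ℕ; zero; suc; _+_; _*_; _∸_; _≤_; _⊔_; _⊓_; ∣_-_∣)
open import Data.Nat.DivMod using (_/_)
open import Data.Fin using (Fin; zero; suc)
open import Data.Fin.Properties using (_≟_)
open import Data.Product using (_×_; _,_)
open import Data.List using (List; foldr; allFin; cartesianProduct)
open import Relation.Nullary using (yes; no)
open import Relation.Binary.PropositionalEquality using (_≡_; _≢_)

-- Star S_m on m vertices: vertices Fin m, vertex zero is the center c,
-- the others are the m-1 leaves.
starDist : {m : ℕ} → Fin m → Fin m → ℕ
starDist a b with a ≟ b
... | yes _ = 0
starDist zero    _       | no _ = 1
starDist (suc _) zero    | no _ = 1
starDist (suc _) (suc _) | no _ = 2

row : ℕ → Fin 3 → ℕ
row n zero             = 1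
row n (suc zero)       = (n + 1) / 2
row n (suc (suc zero)) = n

-- Vertices of G(*): (a , r) stands for the vertex (a , row n r) of G_{m,n}.
Vtx : ℕ → Set
Vtx m = Fin m × Fin 3

dist : (m n : ℕ) → Vtx m → Vtx m → ℕ
dist m n (a , r) (b , s) = starDist a b + ∣ row n r - row n s ∣

diam : ℕ → ℕ
diam n = n + 1

IsRadioLabeling : (m n : ℕ) → (Vtx m → ℕ) → Set
IsRadioLabeling m n f =
  ∀ u v → u ≢ v → diam n + 1 ∸ dist m n u v ≤ ∣ f u - f v ∣

allVtx : (m : ℕ) → List (Vtx m)
allVtx m = cartesianProduct (allFin m) (allFin 3)

maxLabel : (m : ℕ) → (Vtx m → ℕ) → ℕ
maxLabel m f = foldr (λ v acc → f v ⊔ acc) 0 (allVtx m)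

-- Starts from maxLabel (an upper bound of all values), so this is the minimum.
minLabel : (m : ℕ) → (Vtx m → ℕ) → ℕ
minLabel m f = foldr (λ v acc → f v ⊓ acc) (maxLabel m f) (allVtx m)

span : (m : ℕ) → (Vtx m → ℕ) → ℕ
span m f = maxLabel m f ∸ minLabel m f

module Submission where

-- Sort the 3m vertices by label, v₀, …, v_{3m−1}. Let the level of a vertex be its distance to
-- the centre of the middle star, so that d(u, v) ≤ level u + level v. The radio condition then
-- makes consecutive labels differ by at least n + 2 − level vᵢ − level vᵢ₊₁, and telescoping gives
--   span ≥ (3m − 1)(n + 2) − 2 Σ level + level v₀ + level v_{3m−1}.
-- The theorem needs (n − 3)/2 more than (3m − 1)(n + 2) − 2 Σ level. If v₀ or v_{3m−1} lies in an
-- end row, its level of at least (n − 1)/2 provides it. Otherwise three consecutive vᵢ lie in end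
-- rows, as there would else be at most 2(m − 1) end-row vertices; two of the three share a row,
-- where the distance bound is n − 1 better, and the step across the triple gains enough.

open import Defs
open import Data.Bool using (Bool; true; false; not; T; if_then_else_)
open import Data.Empty using (⊥-elim)
open import Data.Fin using (Fin; zero; suc)
open import Data.Fin.Properties using (_≟_)
open import Data.List using (List; []; _∷_; _++_; length; map; foldr; tabulate; allFin; cartesianProduct)
open import Data.List.Properties using (map-++; map-∘; map-tabulate; length-tabulate)
open import Data.List.Membership.Propositional using (_∈_)
open import Data.List.Membership.Propositional.Properties using (∈-allFin; ∈-cartesianProduct⁺)
open import Data.List.Relation.Unary.Any using (here; there)
open import Data.List.Relation.Unary.All using (_∷_)
open import Data.List.Relation.Unary.AllPairs using (AllPairs; _∷_)
open import Data.List.Relation.Unary.Linked using (Linked; _∷_)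
open import Data.List.Relation.Unary.Unique.Propositional using (Unique)
import Data.List.Relation.Unary.Unique.Propositional.Properties as Unique
open import Data.List.Relation.Binary.Permutation.Propositional using (_↭_; ↭-sym; ↭⇒↭ₛ)
open import Data.List.Relation.Binary.Permutation.Propositional.Properties using (map⁺; ↭-length)
import Data.List.Relation.Binary.Permutation.Setoid.Properties as Setoid↭
import Data.List.Sort
open import Data.Nat using (ℕ; zero; suc; _+_; _*_; _∸_; _≤_; _⊔_; _⊓_; ∣_-_∣; z≤n; s≤s)
open import Data.Nat.Properties hiding (_≟_)
open import Data.Nat.DivMod using (_/_; _%_; m*n/n≡m; m≡m%n+[m/n]*n)
open import Data.Nat.ListAction using (sum)
open import Data.Nat.ListAction.Properties using (sum-++; sum-↭)
open import Data.Nat.Tactic.RingSolver using (solve-∀)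
open import Data.Product using (_×_; _,_; proj₂; ∃)
open import Data.Sum using (_⊎_; inj₁; inj₂)
open import Function using (_∘_; _on_; id)
open import Relation.Nullary using (yes; no)
open import Relation.Binary.PropositionalEquality
import Relation.Binary.Construct.On as On
open import Algebra.Properties.CommutativeSemigroup +-commutativeSemigroup
  using (interchange; x∙yz≈y∙xz; xy∙z≈x∙zy; xy∙z≈xz∙y; xy∙z≈y∙xz)


-- f x + c ≤ f y + w is the subtraction-free form of f y − f x ≥ c − w.
module _ {A : Set} (f : A → ℕ) where

  offset-trans : ∀ {x y z c c′ w w′} → f x + c ≤ f y + w → f y + c′ ≤ f z + w′ →
    f x + (c + c′) ≤ f z + (w + w′)
  offset-trans {x} {y} {z} {c} {c′} {w} {w′} p q = +-cancelʳ-≤ (f y) _ _ (begin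
    f x + (c + c′) + f y       ≡⟨ shuffle (f x) (f y) c c′ ⟩
    (f x + c) + (f y + c′)     ≤⟨ +-mono-≤ p q ⟩
    (f y + w) + (f z + w′)     ≡⟨ unshuffle (f y) (f z) w w′ ⟩
    f z + (w + w′) + f y       ∎)
    where
    open ≤-Reasoning
    shuffle : ∀ a b c c′ → a + (c + c′) + b ≡ (a + c) + (b + c′)
    shuffle = solve-∀
    unshuffle : ∀ b d w w′ → (b + w) + (d + w′) ≡ d + (w + w′) + b
    unshuffle = solve-∀

  offset-weaken : ∀ {x y c c′ w w′} → f x + c ≤ f y + w → c′ + w ≤ c + w′ → f x + c′ ≤ f y + w′
  offset-weaken {x} {y} {c} {c′} {w} {w′} p q = +-cancelʳ-≤ w _ _ (begin
    f x + c′ + w     ≡⟨ +-assoc (f x) c′ w ⟩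
    f x + (c′ + w)   ≤⟨ +-monoʳ-≤ (f x) q ⟩
    f x + (c + w′)   ≡⟨ +-assoc (f x) c w′ ⟨
    f x + c + w′     ≤⟨ +-monoˡ-≤ w′ p ⟩
    f y + w + w′     ≡⟨ +-assoc (f y) w w′ ⟩
    f y + (w + w′)   ≡⟨ cong (f y +_) (+-comm w w′) ⟩
    f y + (w′ + w)   ≡⟨ +-assoc (f y) w′ w ⟨
    f y + w′ + w     ∎)
    where open ≤-Reasoning

lastOf : ∀ {A : Set} → A → List A → A
lastOf x []       = x
lastOf x (y ∷ ys) = lastOf y ys

lastOf-map : ∀ {A B : Set} (g : A → B) x xs → lastOf (g x) (map g xs) ≡ g (lastOf x xs)
lastOf-map g x []       = refl
lastOf-map g x (y ∷ ys) = lastOf-map g y ys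

sum-map-const : ∀ {A : Set} {g : A → ℕ} {c} → (∀ x → g x ≡ c) → ∀ xs → sum (map g xs) ≡ length xs * c
sum-map-const g≡c []       = refl
sum-map-const g≡c (x ∷ xs) = cong₂ _+_ (g≡c x) (sum-map-const g≡c xs)

length≡sum-map-1 : ∀ {A : Set} (xs : List A) → length xs ≡ sum (map (λ _ → 1) xs)
length≡sum-map-1 xs = sym (trans (sum-map-const (λ _ → refl) xs) (*-identityʳ (length xs)))

sum-map-cartesianProduct : ∀ {A B : Set} (w : A × B → ℕ) (as : List A) (bs : List B) →
  sum (map w (cartesianProduct as bs)) ≡ sum (map (λ a → sum (map (λ b → w (a , b)) bs)) as)
sum-map-cartesianProduct w []       bs = refl
sum-map-cartesianProduct w (a ∷ as) bs = begin
  sum (map w (map (a ,_) bs ++ cartesianProduct as bs))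
    ≡⟨ cong sum (map-++ w (map (a ,_) bs) _) ⟩
  sum (map w (map (a ,_) bs) ++ map w (cartesianProduct as bs))
    ≡⟨ sum-++ (map w (map (a ,_) bs)) _ ⟩
  sum (map w (map (a ,_) bs)) + sum (map w (cartesianProduct as bs))
    ≡⟨ cong₂ _+_ (cong sum (sym (map-∘ bs))) (sum-map-cartesianProduct w as bs) ⟩
  sum (map (λ b → w (a , b)) bs) + sum (map (λ a → sum (map (λ b → w (a , b)) bs)) as) ∎
  where open ≡-Reasoning

data ThreeInARow {A : Set} (P : A → Set) : List A → Set where
  here  : ∀ {x y z xs} → P x → P y → P z → ThreeInARow P (x ∷ y ∷ z ∷ xs)
  there : ∀ {x xs} → ThreeInARow P xs → ThreeInARow P (x ∷ xs)

ThreeInARow-map⁻ : ∀ {A B : Set} {P : B → Set} (g : A → B) {xs} →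
  ThreeInARow P (map g xs) → ThreeInARow (P ∘ g) xs
ThreeInARow-map⁻ g {x ∷ y ∷ z ∷ xs} (here px py pz) = here px py pz
ThreeInARow-map⁻ g {x ∷ xs}         (there t)       = there (ThreeInARow-map⁻ g t)

indicator : Bool → ℕ
indicator b = if b then 1 else 0

trues falses : List Bool → ℕ
trues  = sum ∘ map indicator
falses = sum ∘ map (indicator ∘ not)

leadingTrues : List Bool → ℕ
leadingTrues (true ∷ bs) = suc (leadingTrues bs)
leadingTrues _           = 0

three-leadingTrues : ∀ bs → 3 ≤ leadingTrues bs → ThreeInARow T bs
three-leadingTrues (true ∷ true ∷ true ∷ bs) _      = here _ _ _
three-leadingTrues (true ∷ true ∷ false ∷ bs) (s≤s (s≤s ()))
three-leadingTrues (true ∷ true ∷ []) (s≤s (s≤s ()))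
three-leadingTrues (true ∷ false ∷ bs) (s≤s ())
three-leadingTrues (true ∷ []) (s≤s ())

-- Without three trues in a row, each false is followed by at most two trues before the next
-- false; only the leading trues follow no false, and a final false is followed by none.
trues-bound : ∀ b bs → ThreeInARow T (b ∷ bs) ⊎
  trues (b ∷ bs) + (if lastOf b bs then 0 else 2) ≤ 2 * falses (b ∷ bs) + leadingTrues (b ∷ bs)
trues-bound true  []       = inj₂ ≤-refl
trues-bound false []       = inj₂ ≤-refl
trues-bound b     (c ∷ cs) with trues-bound c cs
... | inj₁ three = inj₁ (there three)
trues-bound true  (c ∷ cs) | inj₂ bound = inj₂ (≤-trans (s≤s bound) (≤-reflexive (sym (+-suc _ _))))
trues-bound false (c ∷ cs) | inj₂ bound with leadingTrues (c ∷ cs) ≤? 2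
... | no  lead≰2 = inj₁ (there (three-leadingTrues (c ∷ cs) (≰⇒> lead≰2)))
... | yes lead≤2 = inj₂ (≤-trans bound
  (≤-trans (+-monoʳ-≤ _ lead≤2) (≤-reflexive (double-suc (falses (c ∷ cs))))))
  where
  double-suc : ∀ F → 2 * F + 2 ≡ 2 * (1 + F) + 0
  double-suc = solve-∀

threeInARow⊎trueEnd : ∀ b bs → 2 * falses (b ∷ bs) ≤ trues (b ∷ bs) + 1 →
  ThreeInARow T (b ∷ bs) ⊎ T b ⊎ T (lastOf b bs)
threeInARow⊎trueEnd true  bs _ = inj₂ (inj₁ _)
threeInARow⊎trueEnd false bs few with lastOf false bs | trues-bound false bs
... | true  | _          = inj₂ (inj₂ _)
... | false | inj₁ three = inj₁ three
... | false | inj₂ bound = ⊥-elim (1+n≰n (+-cancelˡ-≤ (trues (false ∷ bs)) _ _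
        (≤-trans bound (≤-trans (≤-reflexive (+-identityʳ _)) few))))

module Telescope {A : Set} (f L : A → ℕ) (N : ℕ)
  (gap : ∀ {x y} → x ≢ y → f x ≤ f y → f x + N ≤ f y + (L x + L y)) where

  edgeWeight : A → List A → ℕ
  edgeWeight x []       = 0
  edgeWeight x (y ∷ ys) = L x + L y + edgeWeight y ys

  edgeWeight+ends : ∀ x xs → edgeWeight x xs + (L x + L (lastOf x xs)) ≡ 2 * sum (map L (x ∷ xs))
  edgeWeight+ends x []       = double (L x)
    where
    double : ∀ a → a + a ≡ 2 * (a + 0)
    double = solve-∀
  edgeWeight+ends x (y ∷ ys) = begin
    L x + L y + edgeWeight y ys + (L x + L (lastOf y ys)) ≡⟨ regroup (L x) (L y) (edgeWeight y ys) (L (lastOf y ys)) ⟩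
    2 * L x + (edgeWeight y ys + (L y + L (lastOf y ys)))  ≡⟨ cong (2 * L x +_) (edgeWeight+ends y ys) ⟩
    2 * L x + 2 * sum (map L (y ∷ ys))                     ≡⟨ *-distribˡ-+ 2 (L x) _ ⟨
    2 * sum (map L (x ∷ y ∷ ys))                           ∎
    where
    open ≡-Reasoning
    regroup : ∀ a b e l → a + b + e + (a + l) ≡ 2 * a + (e + (b + l))
    regroup = solve-∀

  edgeWeight≤ : ∀ x xs → edgeWeight x xs ≤ 2 * sum (map L (x ∷ xs))
  edgeWeight≤ x xs = ≤-trans (m≤m+n _ _) (≤-reflexive (edgeWeight+ends x xs))

  Increasing : List A → Set
  Increasing = Linked (_≤_ on f)

  telescope : ∀ x xs → Increasing (x ∷ xs) → AllPairs _≢_ (x ∷ xs) →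
    f x + length xs * N ≤ f (lastOf x xs) + edgeWeight x xs
  telescope x []       _                 _                          = ≤-refl
  telescope x (y ∷ ys) (fx≤fy ∷ ordered) ((x≢y ∷ _) ∷ distinct) =
    offset-trans f (gap x≢y fx≤fy) (telescope y ys ordered distinct)

  telescope-ends : ∀ {B} x xs → Increasing (x ∷ xs) → AllPairs _≢_ (x ∷ xs) → B ≤ L x + L (lastOf x xs) →
    f x + (length xs * N + B) ≤ f (lastOf x xs) + 2 * sum (map L (x ∷ xs))
  telescope-ends {B} x xs ordered distinct B≤ends = offset-weaken f (telescope x xs ordered distinct) (begin
    length xs * N + B + edgeWeight x xs                         ≤⟨ +-monoˡ-≤ (edgeWeight x xs) (+-monoʳ-≤ (length xs * N) B≤ends) ⟩
    length xs * N + (L x + L (lastOf x xs)) + edgeWeight x xs   ≡⟨ +-assoc (length xs * N) _ _ ⟩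
    length xs * N + (L x + L (lastOf x xs) + edgeWeight x xs)   ≡⟨ cong (length xs * N +_) (+-comm _ (edgeWeight x xs)) ⟩
    length xs * N + (edgeWeight x xs + (L x + L (lastOf x xs))) ≡⟨ cong (length xs * N +_) (edgeWeight+ends x xs) ⟩
    length xs * N + 2 * sum (map L (x ∷ xs))                    ∎)
    where open ≤-Reasoning

  module _ (P : A → Set) (bonus : ℕ)
    (triple : ∀ {x y z} → P x → P y → P z → x ≢ y → y ≢ z → x ≢ z → f x ≤ f y → f y ≤ f z →
              f x + (N + N + bonus) ≤ f z + (L x + L y + (L y + L z))) where

    telescope-bonus : ∀ x xs → Increasing (x ∷ xs) → AllPairs _≢_ (x ∷ xs) → ThreeInARow P (x ∷ xs) →
      f x + (length xs * N + bonus) ≤ f (lastOf x xs) + edgeWeight x xs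
    telescope-bonus x (y ∷ z ∷ zs) (fx≤fy ∷ fy≤fz ∷ ordered)
      ((x≢y ∷ x≢z ∷ _) ∷ (y≢z ∷ _) ∷ distinct) (here px py pz) =
      offset-weaken f
        (offset-trans f (triple px py pz x≢y y≢z x≢z fx≤fy fy≤fz) (telescope z zs ordered distinct))
        (≤-reflexive (regroup N bonus (length zs * N) (L x) (L y) (L z) (edgeWeight z zs)))
      where
      regroup : ∀ N b t x y z e → N + (N + t) + b + (x + y + (y + z) + e) ≡ N + N + b + t + (x + y + (y + z + e))
      regroup = solve-∀
    telescope-bonus x (y ∷ ys) (fx≤fy ∷ ordered) ((x≢y ∷ _) ∷ distinct) (there three) =
      offset-weaken f (offset-trans f (gap x≢y fx≤fy) (telescope-bonus y ys ordered distinct three))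
        (≤-reflexive (cong (_+ (L x + L y + edgeWeight y ys)) (+-assoc N (length ys * N) bonus)))
    telescope-bonus x [] _ _ (there ())

depth : ∀ {m} → Fin m → ℕ
depth zero    = 0
depth (suc _) = 1

starDist≤depth+depth : ∀ {m} (a b : Fin m) → starDist a b ≤ depth a + depth b
starDist≤depth+depth a b with a ≟ b
... | yes _ = z≤n
starDist≤depth+depth zero    zero    | no a≢b = ⊥-elim (a≢b refl)
starDist≤depth+depth zero    (suc _) | no _   = ≤-refl
starDist≤depth+depth (suc _) zero    | no _   = ≤-refl
starDist≤depth+depth (suc _) (suc _) | no _   = ≤-refl

isEndRow : Fin 3 → Bool
isEndRow zero             = true
isEndRow (suc zero)       = false
isEndRow (suc (suc zero)) = true

isEndVertex : ∀ {m} → Vtx m → Bool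
isEndVertex = isEndRow ∘ proj₂

endRows-collide : ∀ {r s t} → T (isEndRow r) → T (isEndRow s) → T (isEndRow t) → r ≡ s ⊎ s ≡ t ⊎ r ≡ t
endRows-collide {zero}           {zero}                            _ _ _ = inj₁ refl
endRows-collide {suc (suc zero)} {suc (suc zero)}                  _ _ _ = inj₁ refl
endRows-collide {zero}           {suc (suc zero)} {zero}           _ _ _ = inj₂ (inj₂ refl)
endRows-collide {zero}           {suc (suc zero)} {suc (suc zero)} _ _ _ = inj₂ (inj₁ refl)
endRows-collide {suc (suc zero)} {zero}           {zero}           _ _ _ = inj₂ (inj₁ refl)
endRows-collide {suc (suc zero)} {zero}           {suc (suc zero)} _ _ _ = inj₂ (inj₂ refl)
endRows-collide {suc zero} ()
endRows-collide {zero}           {suc zero} _ ()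
endRows-collide {suc (suc zero)} {suc zero} _ ()

radio-gap : ∀ {m n} (f : Vtx m → ℕ) → IsRadioLabeling m n f → ∀ {u v} → u ≢ v → f u ≤ f v →
  f u + (diam n + 1) ≤ f v + dist m n u v
radio-gap {m} {n} f rad {u} {v} u≢v fu≤fv = begin
  f u + (diam n + 1)                ≤⟨ +-monoʳ-≤ (f u) (m≤n+m∸n (diam n + 1) d) ⟩
  f u + (d + (diam n + 1 ∸ d))      ≤⟨ +-monoʳ-≤ (f u) (+-monoʳ-≤ d label-gap) ⟩
  f u + (d + (f v ∸ f u))           ≡⟨ x∙yz≈y∙xz (f u) d (f v ∸ f u) ⟩
  d + (f u + (f v ∸ f u))           ≡⟨ cong (d +_) (m+[n∸m]≡n fu≤fv) ⟩
  d + f v                           ≡⟨ +-comm d (f v) ⟩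
  f v + d                           ∎
  where
  open ≤-Reasoning
  d : ℕ
  d = dist m n u v
  label-gap : diam n + 1 ∸ d ≤ f v ∸ f u
  label-gap = subst (diam n + 1 ∸ d ≤_) (m≤n⇒∣m-n∣≡n∸m fu≤fv) (rad u v u≢v)

sum-map-↭ : ∀ {A : Set} (w : A → ℕ) {xs ys} → xs ↭ ys → sum (map w xs) ≡ sum (map w ys)
sum-map-↭ w xs↭ys = sum-↭ (map⁺ w xs↭ys)

sum-allVtx : ∀ m (w : Vtx (suc m) → ℕ) {c} → (∀ i → sum (map (λ r → w (suc i , r)) (allFin 3)) ≡ c) →
  sum (map w (allVtx (suc m))) ≡ sum (map (λ r → w (zero , r)) (allFin 3)) + m * c
sum-allVtx m w {c} leafSum = begin
  sum (map w (allVtx (suc m)))                   ≡⟨ sum-map-cartesianProduct w (allFin (suc m)) (allFin 3) ⟩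
  rowSum zero + sum (map rowSum (tabulate suc))   ≡⟨ cong (λ t → rowSum zero + sum t) (map-tabulate suc rowSum) ⟩
  rowSum zero + sum (tabulate (rowSum ∘ suc))     ≡⟨ cong (λ t → rowSum zero + sum t) (map-tabulate id (rowSum ∘ suc)) ⟨
  rowSum zero + sum (map (rowSum ∘ suc) (allFin m)) ≡⟨ cong (rowSum zero +_) (sum-map-const leafSum (allFin m)) ⟩
  rowSum zero + length (allFin m) * c             ≡⟨ cong (λ l → rowSum zero + l * c) (length-tabulate {n = m} id) ⟩
  rowSum zero + m * c                             ∎
  where
  open ≡-Reasoning
  rowSum : Fin (suc m) → ℕ
  rowSum a = sum (map (λ r → w (a , r)) (allFin 3))

length-allVtx : ∀ m → length (allVtx (suc m)) ≡ 3 + m * 3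
length-allVtx m = trans (length≡sum-map-1 (allVtx (suc m))) (sum-allVtx m (λ _ → 1) (λ _ → refl))

trues-allVtx : ∀ m → trues (map isEndVertex (allVtx (suc m))) ≡ 2 + m * 2
trues-allVtx m = trans (cong sum (sym (map-∘ {g = indicator} {f = isEndVertex} (allVtx (suc m)))))
  (sum-allVtx m (indicator ∘ isEndVertex) (λ _ → refl))

falses-allVtx : ∀ m → falses (map isEndVertex (allVtx (suc m))) ≡ 1 + m * 1
falses-allVtx m = trans (cong sum (sym (map-∘ {g = indicator ∘ not} {f = isEndVertex} (allVtx (suc m)))))
  (sum-allVtx m (indicator ∘ not ∘ isEndVertex) (λ _ → refl))

∈-allVtx : ∀ {m} (v : Vtx m) → v ∈ allVtx m
∈-allVtx (a , r) = ∈-cartesianProduct⁺ (∈-allFin a) (∈-allFin r)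

unique-allVtx : ∀ m → Unique (allVtx m)
unique-allVtx m = Unique.cartesianProduct⁺ (Unique.allFin⁺ m) (Unique.allFin⁺ 3)

module _ {A : Set} (f : A → ℕ) where

  ≤-foldr-⊔ : ∀ {x} xs → x ∈ xs → f x ≤ foldr (λ v acc → f v ⊔ acc) 0 xs
  ≤-foldr-⊔ (y ∷ ys) (here refl) = m≤m⊔n (f y) _
  ≤-foldr-⊔ (y ∷ ys) (there x∈ys) = m≤n⇒m≤o⊔n (f y) (≤-foldr-⊔ ys x∈ys)

  foldr-⊓-≤ : ∀ e {x} xs → x ∈ xs → foldr (λ v acc → f v ⊓ acc) e xs ≤ f x
  foldr-⊓-≤ e (y ∷ ys) (here refl)  = m⊓n≤m (f y) _
  foldr-⊓-≤ e (y ∷ ys) (there x∈ys) = m≤n⇒o⊓m≤n (f y) (foldr-⊓-≤ e ys x∈ys)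

  foldr-⊓-≤-init : ∀ e xs → foldr (λ v acc → f v ⊓ acc) e xs ≤ e
  foldr-⊓-≤-init e []       = ≤-refl
  foldr-⊓-≤-init e (y ∷ ys) = m≤n⇒o⊓m≤n (f y) (foldr-⊓-≤-init e ys)

label≤span+label : ∀ {m} (f : Vtx m → ℕ) u v → f v ≤ span m f + f u
label≤span+label {m} f u v = begin
  f v                                ≤⟨ ≤-foldr-⊔ f (allVtx m) (∈-allVtx v) ⟩
  maxLabel m f                       ≡⟨ m∸n+n≡m (foldr-⊓-≤-init f (maxLabel m f) (allVtx m)) ⟨
  span m f + minLabel m f            ≤⟨ +-monoʳ-≤ (span m f) (foldr-⊓-≤ f (maxLabel m f) (allVtx m) (∈-allVtx u)) ⟩
  span m f + f u                     ∎
  where open ≤-Reasoning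

module Levels (h : ℕ) where

  n N : ℕ
  n = 1 + 2 * h
  N = diam n + 1

  rowLevel : Fin 3 → ℕ
  rowLevel r = if isEndRow r then h else 0

  level : ∀ {m} → Vtx m → ℕ
  level (a , r) = depth a + rowLevel r

  middleRow : row n (suc zero) ≡ suc h
  middleRow = trans (cong (_/ 2) (twice-suc h)) (m*n/n≡m (suc h) 2)
    where
    twice-suc : ∀ h → 1 + 2 * h + 1 ≡ suc h * 2
    twice-suc = solve-∀

  rowLevel≡∣row-middleRow∣ : ∀ r → rowLevel r ≡ ∣ row n r - row n (suc zero) ∣
  rowLevel≡∣row-middleRow∣ zero             rewrite middleRow = refl
  rowLevel≡∣row-middleRow∣ (suc zero)       rewrite middleRow = sym (∣n-n∣≡0 (suc h))
  rowLevel≡∣row-middleRow∣ (suc (suc zero)) rewrite middleRow = sym (begin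
    ∣ 2 * h - h ∣ ≡⟨ cong (λ t → ∣ h + t - h ∣) (+-identityʳ h) ⟩
    ∣ h + h - h ∣ ≡⟨ ∣-∣-comm (h + h) h ⟩
    ∣ h - h + h ∣ ≡⟨ ∣m-m+n∣≡n h h ⟩
    h             ∎)
    where open ≡-Reasoning

  rowLevel-end : ∀ {r} → T (isEndRow r) → rowLevel r ≡ h
  rowLevel-end {zero}           _ = refl
  rowLevel-end {suc (suc zero)} _ = refl

  ∣row-row∣≤rowLevel+rowLevel : ∀ r s → ∣ row n r - row n s ∣ ≤ rowLevel r + rowLevel s
  ∣row-row∣≤rowLevel+rowLevel r s = begin
    ∣ row n r - row n s ∣                               ≤⟨ ∣-∣-triangle (row n r) (row n (suc zero)) (row n s) ⟩
    ∣ row n r - row n (suc zero) ∣ + ∣ row n (suc zero) - row n s ∣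
      ≡⟨ cong₂ _+_ (rowLevel≡∣row-middleRow∣ r) (trans (rowLevel≡∣row-middleRow∣ s) (∣-∣-comm (row n s) _)) ⟨
    rowLevel r + rowLevel s                             ∎
    where open ≤-Reasoning

  dist≤level+level : ∀ {m} (u v : Vtx m) → dist m n u v ≤ level u + level v
  dist≤level+level (a , r) (b , s) = begin
    starDist a b + ∣ row n r - row n s ∣          ≤⟨ +-mono-≤ (starDist≤depth+depth a b) (∣row-row∣≤rowLevel+rowLevel r s) ⟩
    (depth a + depth b) + (rowLevel r + rowLevel s) ≡⟨ interchange (depth a) (depth b) (rowLevel r) (rowLevel s) ⟩
    level (a , r) + level (b , s)                   ∎
    where open ≤-Reasoning

  dist-sameRow : ∀ {m} (a b : Fin m) r →
    dist m n (a , r) (b , r) + (rowLevel r + rowLevel r) ≤ level (a , r) + level (b , r)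
  dist-sameRow a b r = begin
    starDist a b + ∣ row n r - row n r ∣ + (rowLevel r + rowLevel r)
      ≡⟨ cong (λ t → starDist a b + t + (rowLevel r + rowLevel r)) (∣n-n∣≡0 (row n r)) ⟩
    starDist a b + 0 + (rowLevel r + rowLevel r)
      ≤⟨ +-monoˡ-≤ _ (≤-trans (≤-reflexive (+-identityʳ _)) (starDist≤depth+depth a b)) ⟩
    (depth a + depth b) + (rowLevel r + rowLevel r)
      ≡⟨ interchange (depth a) (depth b) (rowLevel r) (rowLevel r) ⟩
    level (a , r) + level (b , r) ∎
    where open ≤-Reasoning

  h≤level-end : ∀ {m} {v : Vtx m} → T (isEndVertex v) → h ≤ level v
  h≤level-end {v = a , r} end = ≤-trans (≤-reflexive (sym (rowLevel-end end))) (m≤n+m _ (depth a))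

  outerPair-slack : ∀ {B ℓ x z} → B + 3 ≤ h + h → h ≤ ℓ →
    N + N + B + (x + z) ≤ N + (h + h) + (x + ℓ + (ℓ + z))
  outerPair-slack {B} {ℓ} {x} {z} B+3≤2h h≤ℓ = begin
    N + N + B + (x + z)                  ≡⟨ regroup h B x z ⟩
    N + (h + h) + (x + z) + (B + 3)      ≤⟨ +-monoʳ-≤ (N + (h + h) + (x + z)) B+3≤2h ⟩
    N + (h + h) + (x + z) + (h + h)      ≡⟨ spread h x z ⟩
    N + (h + h) + (x + h + (h + z))      ≤⟨ +-monoʳ-≤ (N + (h + h)) (+-mono-≤ (+-monoʳ-≤ x h≤ℓ) (+-monoˡ-≤ z h≤ℓ)) ⟩
    N + (h + h) + (x + ℓ + (ℓ + z))      ∎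
    where
    open ≤-Reasoning
    regroup : ∀ h B x z → (1 + 2 * h + 1 + 1) + (1 + 2 * h + 1 + 1) + B + (x + z)
                        ≡ (1 + 2 * h + 1 + 1) + (h + h) + (x + z) + (B + 3)
    regroup = solve-∀
    spread : ∀ h x z → (1 + 2 * h + 1 + 1) + (h + h) + (x + z) + (h + h)
                     ≡ (1 + 2 * h + 1 + 1) + (h + h) + (x + h + (h + z))
    spread = solve-∀

  -- Three consecutive end-row vertices whose outer two share a row gain only 2h − 3 over the level bound.
  Admissible : ℕ → Set
  Admissible B = B ≡ 0 ⊎ B + 3 ≤ h + h

  bonus≤h+h : ∀ {B} → Admissible B → B ≤ h + h
  bonus≤h+h (inj₁ refl)    = z≤n
  bonus≤h+h (inj₂ B+3≤2h) = ≤-trans (m≤m+n _ 3) B+3≤2h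

  module _ {m} {f : Vtx m → ℕ} (rad : IsRadioLabeling m n f) where

    level-gap : ∀ {u v} → u ≢ v → f u ≤ f v → f u + N ≤ f v + (level u + level v)
    level-gap {u} {v} u≢v fu≤fv = offset-weaken f (radio-gap f rad u≢v fu≤fv) (+-monoʳ-≤ N (dist≤level+level u v))

    endRow-gap : ∀ {a b r} → T (isEndRow r) → (a , r) ≢ (b , r) → f (a , r) ≤ f (b , r) →
      f (a , r) + (N + (h + h)) ≤ f (b , r) + (level (a , r) + level (b , r))
    endRow-gap {a} {b} {r} end u≢v fu≤fv = offset-weaken f (radio-gap f rad u≢v fu≤fv) (begin
      N + (h + h) + dist m n (a , r) (b , r)                    ≡⟨ cong (λ t → N + (t + t) + dist m n (a , r) (b , r)) (rowLevel-end end) ⟨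
      N + (rowLevel r + rowLevel r) + dist m n (a , r) (b , r)  ≡⟨ xy∙z≈x∙zy N _ _ ⟩
      N + (dist m n (a , r) (b , r) + (rowLevel r + rowLevel r)) ≤⟨ +-monoʳ-≤ N (dist-sameRow a b r) ⟩
      N + (level (a , r) + level (b , r))                      ∎)
      where open ≤-Reasoning

    endTriple : ∀ {B} → Admissible B → ∀ {x y z} →
      T (isEndVertex x) → T (isEndVertex y) → T (isEndVertex z) →
      x ≢ y → y ≢ z → x ≢ z → f x ≤ f y → f y ≤ f z →
      f x + (N + N + B) ≤ f z + (level x + level y + (level y + level z))
    endTriple {B} admissible {a , r} {b , s} {c , t} ex ey ez x≢y y≢z x≢z fx≤fy fy≤fz
      with endRows-collide ex ey ez
    ... | inj₁ refl = offset-weaken f (offset-trans f (endRow-gap ex x≢y fx≤fy) (level-gap y≢z fy≤fz))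
      (+-monoˡ-≤ _ (≤-trans (+-monoʳ-≤ (N + N) (bonus≤h+h admissible)) (≤-reflexive (xy∙z≈xz∙y N N (h + h)))))
    ... | inj₂ (inj₁ refl) = offset-weaken f (offset-trans f (level-gap x≢y fx≤fy) (endRow-gap ey y≢z fy≤fz))
      (+-monoˡ-≤ _ (≤-trans (+-monoʳ-≤ (N + N) (bonus≤h+h admissible)) (≤-reflexive (+-assoc N N (h + h)))))
    ... | inj₂ (inj₂ refl) with admissible
    ...   | inj₁ refl = offset-weaken f (offset-trans f (level-gap x≢y fx≤fy) (level-gap y≢z fy≤fz))
      (≤-reflexive (cong (_+ (level (a , r) + level (b , s) + (level (b , s) + level (c , r)))) (+-identityʳ (N + N))))
    ...   | inj₂ B+3≤2h = offset-weaken f (endRow-gap ex x≢z (≤-trans fx≤fy fy≤fz))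
      (outerPair-slack {x = level (a , r)} {z = level (c , r)} B+3≤2h (h≤level-end ey))

  sum-level-allVtx : ∀ m → sum (map level (allVtx (suc m))) ≡ h + h + m * (2 * h + 3)
  sum-level-allVtx m = trans (sum-allVtx m level (λ _ → leafRow h)) (cong (λ t → h + t + m * (2 * h + 3)) (+-identityʳ h))
    where
    leafRow : ∀ h → 1 + h + (1 + 0 + (1 + h + 0)) ≡ 2 * h + 3
    leafRow = solve-∀

module SortedLabels (h m : ℕ) {f : Vtx (suc m) → ℕ} (rad : IsRadioLabeling (suc m) (Levels.n h) f) where
  open Levels h
  open Telescope f level N (level-gap rad)
  open Data.List.Sort (On.decTotalOrder ≤-decTotalOrder f) using (sort; sort-↭; sort-↗)

  ↭allVtx⇒distinct : ∀ {xs} → xs ↭ allVtx (suc m) → AllPairs _≢_ xs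
  ↭allVtx⇒distinct perm = Setoid↭.Unique-resp-↭ (setoid _) (↭⇒↭ₛ (↭-sym perm)) (unique-allVtx (suc m))

  ↭allVtx⇒few-falses : ∀ {xs} → xs ↭ allVtx (suc m) →
    2 * falses (map isEndVertex xs) ≤ trues (map isEndVertex xs) + 1
  ↭allVtx⇒few-falses {xs} perm = begin
    2 * falses (map isEndVertex xs)       ≡⟨ cong (2 *_) (trans (sum-map-↭ (indicator ∘ not) ends↭) (falses-allVtx m)) ⟩
    2 * (1 + m * 1)                       ≡⟨ twice m ⟩
    2 + m * 2                             ≤⟨ m≤m+n _ 1 ⟩
    2 + m * 2 + 1                         ≡⟨ cong (_+ 1) (trans (sum-map-↭ indicator ends↭) (trues-allVtx m)) ⟨
    trues (map isEndVertex xs) + 1        ∎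
    where
    open ≤-Reasoning
    ends↭ : map isEndVertex xs ↭ map isEndVertex (allVtx (suc m))
    ends↭ = map⁺ isEndVertex perm
    twice : ∀ m → 2 * (1 + m * 1) ≡ 2 + m * 2
    twice = solve-∀

  spread-sorted : ∀ {B} → B ≤ h → Admissible B → ∀ x xs → x ∷ xs ↭ allVtx (suc m) → Increasing (x ∷ xs) →
    f x + (length xs * N + B) ≤ f (lastOf x xs) + 2 * sum (map level (x ∷ xs))
  spread-sorted {B} B≤h admissible x xs perm ordered
    with threeInARow⊎trueEnd (isEndVertex x) (map isEndVertex xs) (↭allVtx⇒few-falses perm)
  ... | inj₁ three = ≤-trans
    (telescope-bonus (T ∘ isEndVertex) B (endTriple rad admissible) x xs ordered (↭allVtx⇒distinct perm)
      (ThreeInARow-map⁻ isEndVertex three))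
    (+-monoʳ-≤ (f (lastOf x xs)) (edgeWeight≤ x xs))
  ... | inj₂ (inj₁ first-end) = telescope-ends x xs ordered (↭allVtx⇒distinct perm)
    (≤-trans B≤h (m≤n⇒m≤n+o (level (lastOf x xs)) (h≤level-end {v = x} first-end)))
  ... | inj₂ (inj₂ last-end)  = telescope-ends x xs ordered (↭allVtx⇒distinct perm)
    (≤-trans B≤h (m≤n⇒m≤o+n (level x)
      (h≤level-end {v = lastOf x xs} (subst T (lastOf-map isEndVertex x xs) last-end))))

  span-bound : ∀ {B} → B ≤ h → Admissible B →
    (2 + m * 3) * N + B ≤ span (suc m) f + 2 * (h + h + m * (2 * h + 3))
  span-bound {B} B≤h admissible with sort (allVtx (suc m)) | sort-↭ (allVtx (suc m)) | sort-↗ (allVtx (suc m))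
  ... | []     | perm | _       = ⊥-elim (0≢1+n (↭-length perm))
  ... | x ∷ xs | perm | ordered = +-cancelˡ-≤ (f x) _ _ (begin
    f x + ((2 + m * 3) * N + B)                     ≡⟨ cong (λ l → f x + (l * N + B)) length-xs ⟨
    f x + (length xs * N + B)                       ≤⟨ spread-sorted B≤h admissible x xs perm ordered ⟩
    f (lastOf x xs) + 2 * sum (map level (x ∷ xs))  ≡⟨ cong (λ t → f (lastOf x xs) + 2 * t) sum-level ⟩
    f (lastOf x xs) + 2 * S                         ≤⟨ +-monoˡ-≤ (2 * S) (label≤span+label f x (lastOf x xs)) ⟩
    span (suc m) f + f x + 2 * S                    ≡⟨ xy∙z≈y∙xz (span (suc m) f) (f x) (2 * S) ⟩
    f x + (span (suc m) f + 2 * S)                  ∎)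
    where
    open ≤-Reasoning
    S : ℕ
    S = h + h + m * (2 * h + 3)
    sum-level : sum (map level (x ∷ xs)) ≡ S
    sum-level = trans (sum-map-↭ level perm) (sum-level-allVtx m)
    length-xs : length xs ≡ 2 + m * 3
    length-xs = suc-injective (trans (↭-length perm) (length-allVtx m))

odd⇒1+2[1+k] : ∀ n → 3 ≤ n → n % 2 ≡ 1 → ∃ λ k → n ≡ 1 + 2 * suc k
odd⇒1+2[1+k] n 3≤n odd with n / 2 | m≡m%n+[m/n]*n n 2
... | zero  | n≡ = ⊥-elim (<⇒≱ 3≤n (≤-trans (≤-reflexive (trans n≡ (cong (_+ 0) odd))) (n≤1+n 1)))
... | suc k | n≡ = k , (begin
  n                   ≡⟨ n≡ ⟩
  n % 2 + suc k * 2   ≡⟨ cong (_+ suc k * 2) odd ⟩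
  1 + suc k * 2       ≡⟨ cong (1 +_) (*-comm (suc k) 2) ⟩
  1 + 2 * suc k       ∎)
  where open ≡-Reasoning

bonus-admissible : ∀ k → Levels.Admissible (suc k) k
bonus-admissible zero    = inj₁ refl
bonus-admissible (suc j) = inj₂ (≤-trans (m≤m+n (suc j + 3) j) (≤-reflexive (shift j)))
  where
  shift : ∀ j → suc j + 3 + j ≡ suc (suc j) + suc (suc j)
  shift = solve-∀

span-bound⇒radio-bound : ∀ k m sp → let h = suc k; n = 1 + 2 * h in
  (2 + m * 3) * (n + 1 + 1) + k ≤ sp + 2 * (h + h + m * (2 * h + 3)) →
  2 * suc m * n + 4 * suc m + 5 ≤ 2 * sp + n
span-bound⇒radio-bound k m sp bound = +-cancelʳ-≤ (4 * S) _ _ (begin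
  2 * suc m * n + 4 * suc m + 5 + 4 * S         ≡⟨ doubled k m ⟩
  2 * ((2 + m * 3) * (n + 1 + 1) + k) + n       ≤⟨ +-monoˡ-≤ n (*-monoʳ-≤ 2 bound) ⟩
  2 * (sp + 2 * S) + n                          ≡⟨ collect sp S n ⟩
  2 * sp + n + 4 * S                            ∎)
  where
  open ≤-Reasoning
  h n S : ℕ
  h = suc k
  n = 1 + 2 * h
  S = h + h + m * (2 * h + 3)
  doubled : ∀ k m → let h = suc k; n = 1 + 2 * h; S = h + h + m * (2 * h + 3) in
    2 * suc m * n + 4 * suc m + 5 + 4 * S ≡ 2 * ((2 + m * 3) * (n + 1 + 1) + k) + n
  doubled = solve-∀
  collect : ∀ sp S n → 2 * (sp + 2 * S) + n ≡ 2 * sp + n + 4 * S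
  collect = solve-∀

lemma2 : (m n : ℕ) → 3 ≤ m → 3 ≤ n → n % 2 ≡ 1 →
    (f : Vtx m → ℕ) → IsRadioLabeling m n f →
    2 * m * n + 4 * m + 5 ≤ 2 * span m f + n
lemma2 (suc m) n _ 3≤n odd f rad with odd⇒1+2[1+k] n 3≤n odd
... | k , refl = span-bound⇒radio-bound k m (span (suc m) f)
  (SortedLabels.span-bound (suc k) m {f} rad (n≤1+n k) (bonus-admissible k))
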